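{- Let $n\ge k\ge 1$ be integers. Then both $(-q;q)_{k}\begin{bmatrix}2n\\2k\end{bmatrix}_q$ and $(-q;q)_{k}\begin{bmatrix}2n+1\\2k+1\end{bmatrix}_q$ are divisible in $\mathbb{Z}[q]$ by $$(-q^{n-k+1};q)_{k}=\prod_{j=1}^{k}(1+q^{n-j+1}).$$
   Context: For $n\in\mathbb{N}$, $(a;q)_n=\prod_{0\le k<n}(1-aq^k)$. For $n,k\in\mathbb{N}$, $\begin{bmatrix}n\\k\end{bmatrix}_q=\frac{(q;q)_n}{(q;q)_k(q;q)_{n-k}}$ if $k\le n$ and $0$ if $k>n$ (a polynomial in $q$ with integer coefficients). -}

module Defs where

open import Data.Nat using (ℕ; zero; suc)
open import Data.Integer using (ℤ; 0ℤ; 1ℤ) renaming (_+_ to _+ℤ_; _*_ to _*ℤ_; -_ to -ℤ_)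
open import Data.List using (List; []; _∷_; replicate; _++_)
open import Data.Product using (Σ)
open import Relation.Binary.PropositionalEquality using (_≡_)

-- Polynomials in ℤ[q]: coefficient lists, lowest degree first.
Poly : Set
Poly = List ℤ

coeff : Poly → ℕ → ℤ
coeff []       _       = 0ℤ
coeff (a ∷ f)  zero    = a
coeff (a ∷ f)  (suc i) = coeff f i

infix 4 _≈P_
_≈P_ : Poly → Poly → Set
f ≈P g = ∀ i → coeff f i ≡ coeff g i

infixl 6 _+P_
_+P_ : Poly → Poly → Poly
[]      +P g       = g
(a ∷ f) +P []      = a ∷ f
(a ∷ f) +P (b ∷ g) = (a +ℤ b) ∷ (f +P g)

scale : ℤ → Poly → Poly
scale c []      = []
scale c (a ∷ f) = (c *ℤ a) ∷ scale c f

infixl 7 _*P_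
_*P_ : Poly → Poly → Poly
[]      *P g = []
(a ∷ f) *P g = scale a g +P (0ℤ ∷ (f *P g))

negP : Poly → Poly
negP = scale (-ℤ 1ℤ)

oneP : Poly
oneP = 1ℤ ∷ []

X^ : ℕ → Poly
X^ m = replicate m 0ℤ ++ (1ℤ ∷ [])

poch : Poly → ℕ → Poly
poch a zero    = oneP
poch a (suc k) = poch a k *P (oneP +P negP (a *P X^ k))

gauss : ℕ → ℕ → Poly
gauss zero    zero    = oneP
gauss zero    (suc k) = []
gauss (suc n) zero    = oneP
gauss (suc n) (suc k) = gauss n k +P X^ (suc k) *P gauss n (suc k)

infix 4 _∣P_
_∣P_ : Poly → Poly → Set
d ∣P f = Σ Poly (λ g → f ≈P d *P g)

{-# OPTIONS --safe #-}
module Submission where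

-- Write P s = (1 + q)(1 + q²)⋯(1 + q^s) = (-q;q)_s and [N, K] for Gaussian binomials.  With m = n - k,
-- P m · (-q^(m+1);q)_k = P (k+m), so the claim is that P (k+m) divides P k · P m · [2k+2m, 2k] and
-- P k · P m · [2k+2m+1, 2k+1].  Together with the two mixed parities this is the statement
-- P ⌊(K+M)/2⌋ ∣ P ⌊K/2⌋ · P ⌊M/2⌋ · [K+M, K], proved by induction along the q-Pascal rule.
-- When K + M is odd the Pascal rule gives it at once.  When K + M = 2a is even, the two Pascal terms
-- only give P (a-1) ∣ Z, say Z = P (a-1) · g, and the new factor 1 + q^a comes from the absorption
-- identity (1 - q^(K+1)) [K+M+1, K+1] = (1 - q^(K+M+1)) [K+M, K] and 1 - q^(2a) = (1 - q^a)(1 + q^a):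
-- they show 1 + q^a ∣ (1 - q^e) g for e = K if K is odd, and for e = K/2 and e = M/2 if both are even.
-- The exponents e with this property are closed under sums and differences and contain 2a, so in
-- both cases they contain a; then 1 + q^a divides (1 - q^a) g + (1 + q^a) g = 2g, hence g, as its
-- constant coefficient is 1.

open import Defs
open import Data.Nat using (ℕ; suc; _≤_; _∸_; _*_; _+_)
open import Data.Product using (_×_)

import Data.Nat as ℕ
open import Data.Nat using (zero; _<_; _<?_; s≤s)
import Data.Nat.Properties as ℕₚ
open import Data.Nat.Induction using (<-rec)
open import Data.Nat.GCD using (gcd; GCD; gcd-GCD; gcd[m,n]∣m; gcd[m,n]∣n; module Bézout)
import Data.Nat.Divisibility as ℕᵈ
open import Data.Nat.Coprimality using (Coprime; 1-coprimeTo; coprime-+; coprime-factors)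
open import Data.Nat.Tactic.RingSolver as ℕ-Solver using ()
open import Data.Integer using (ℤ; 0ℤ; 1ℤ; -_; +_; -[1+_]; NonZero)
  renaming (_+_ to _+ℤ_; _*_ to _*ℤ_; _-_ to _-ℤ_)
import Data.Integer.Properties as ℤₚ
open import Data.Integer.Divisibility.Signed using (divides; ∣m∣n⇒∣m-n; 0∣⇒≡0) renaming (_∣_ to _∣ℤ_)
open import Data.Integer.Tactic.RingSolver as ℤ-Solver using ()
open import Data.List using ([]; _∷_)
open import Data.Maybe using (Maybe; just; nothing; map)
open import Data.Product using (∃; _,_; proj₁; proj₂)
open import Function using (_∘_)
open import Level using (0ℓ)
open import Relation.Nullary using (yes; no)
open import Relation.Binary.Bundles using (Setoid)
import Relation.Binary.Reasoning.Setoid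
open import Relation.Binary.PropositionalEquality as ≡ using (_≡_; refl; cong; cong₂; subst)
open import Algebra.Bundles using (CommutativeRing)
open import Tactic.RingSolver using (solve-∀)
open import Tactic.RingSolver.Core.AlmostCommutativeRing using (AlmostCommutativeRing; fromCommutativeRing)

-- The ring ℤ[X]

-- _≈P_ wrapped in a record, so that both polynomials can be read off the type
-- (by unification, and by the reflective ring solver).
infix 4 _≋_
record _≋_ (f g : Poly) : Set where
  constructor mk≋
  field coeff-≡ : f ≈P g
open _≋_ public

≋-refl : ∀ {f} → f ≋ f
≋-refl = mk≋ λ _ → refl

≋-sym : ∀ {f g} → f ≋ g → g ≋ f
≋-sym f≋g = mk≋ λ i → ≡.sym (coeff-≡ f≋g i)

≋-trans : ∀ {f g h} → f ≋ g → g ≋ h → f ≋ h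
≋-trans f≋g g≋h = mk≋ λ i → ≡.trans (coeff-≡ f≋g i) (coeff-≡ g≋h i)

≋-setoid : Setoid 0ℓ 0ℓ
≋-setoid = record
  { Carrier = Poly ; _≈_ = _≋_
  ; isEquivalence = record { refl = ≋-refl ; sym = ≋-sym ; trans = ≋-trans } }

module ≋-Reasoning = Relation.Binary.Reasoning.Setoid ≋-setoid

≡⇒≋ : ∀ {f g} → f ≡ g → f ≋ g
≡⇒≋ refl = ≋-refl

∷-cong : ∀ {a b f g} → a ≡ b → f ≋ g → a ∷ f ≋ b ∷ g
∷-cong a≡b f≋g = mk≋ λ { zero → a≡b ; (suc i) → coeff-≡ f≋g i }

∷-injective : ∀ {a b f g} → a ∷ f ≋ b ∷ g → f ≋ g
∷-injective a∷f≋b∷g = mk≋ λ i → coeff-≡ a∷f≋b∷g (suc i)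

coeff-+P : ∀ f g i → coeff (f +P g) i ≡ coeff f i +ℤ coeff g i
coeff-+P []      g       i       = ≡.sym (ℤₚ.+-identityˡ _)
coeff-+P (a ∷ f) []      i       = ≡.sym (ℤₚ.+-identityʳ _)
coeff-+P (a ∷ f) (b ∷ g) zero    = refl
coeff-+P (a ∷ f) (b ∷ g) (suc i) = coeff-+P f g i

coeff-scale : ∀ c f i → coeff (scale c f) i ≡ c *ℤ coeff f i
coeff-scale c []      i       = ≡.sym (ℤₚ.*-zeroʳ c)
coeff-scale c (a ∷ f) zero    = refl
coeff-scale c (a ∷ f) (suc i) = coeff-scale c f i

+P-cong : ∀ {f f′ g g′} → f ≋ f′ → g ≋ g′ → f +P g ≋ f′ +P g′
+P-cong {f} {f′} {g} {g′} f≋f′ g≋g′ = mk≋ λ i → begin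
  coeff (f +P g) i            ≡⟨ coeff-+P f g i ⟩
  coeff f i +ℤ coeff g i      ≡⟨ cong₂ _+ℤ_ (coeff-≡ f≋f′ i) (coeff-≡ g≋g′ i) ⟩
  coeff f′ i +ℤ coeff g′ i    ≡⟨ coeff-+P f′ g′ i ⟨
  coeff (f′ +P g′) i          ∎
  where open ≡.≡-Reasoning

+P-congˡ : ∀ {f f′} g → f ≋ f′ → f +P g ≋ f′ +P g
+P-congˡ g f≋f′ = +P-cong f≋f′ (≋-refl {g})

+P-congʳ : ∀ f {g g′} → g ≋ g′ → f +P g ≋ f +P g′
+P-congʳ f g≋g′ = +P-cong (≋-refl {f}) g≋g′

+P-comm : ∀ f g → f +P g ≋ g +P f
+P-comm f g = mk≋ λ i → begin
  coeff (f +P g) i          ≡⟨ coeff-+P f g i ⟩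
  coeff f i +ℤ coeff g i    ≡⟨ ℤₚ.+-comm (coeff f i) (coeff g i) ⟩
  coeff g i +ℤ coeff f i    ≡⟨ coeff-+P g f i ⟨
  coeff (g +P f) i          ∎
  where open ≡.≡-Reasoning

+P-assoc : ∀ f g h → (f +P g) +P h ≋ f +P (g +P h)
+P-assoc f g h = mk≋ λ i → begin
  coeff ((f +P g) +P h) i                    ≡⟨ coeff-+P (f +P g) h i ⟩
  coeff (f +P g) i +ℤ coeff h i              ≡⟨ cong (_+ℤ coeff h i) (coeff-+P f g i) ⟩
  (coeff f i +ℤ coeff g i) +ℤ coeff h i      ≡⟨ ℤₚ.+-assoc (coeff f i) (coeff g i) (coeff h i) ⟩
  coeff f i +ℤ (coeff g i +ℤ coeff h i)      ≡⟨ cong (coeff f i +ℤ_) (coeff-+P g h i) ⟨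
  coeff f i +ℤ coeff (g +P h) i              ≡⟨ coeff-+P f (g +P h) i ⟨
  coeff (f +P (g +P h)) i                    ∎
  where open ≡.≡-Reasoning

+P-identityʳ : ∀ f → f +P [] ≋ f
+P-identityʳ []      = ≋-refl
+P-identityʳ (a ∷ f) = ≋-refl

+P-interchange : ∀ f g h k → (f +P g) +P (h +P k) ≋ (f +P h) +P (g +P k)
+P-interchange f g h k = mk≋ λ i → begin
  coeff ((f +P g) +P (h +P k)) i
    ≡⟨ coeff-+P (f +P g) (h +P k) i ⟩
  coeff (f +P g) i +ℤ coeff (h +P k) i
    ≡⟨ cong₂ _+ℤ_ (coeff-+P f g i) (coeff-+P h k i) ⟩
  (coeff f i +ℤ coeff g i) +ℤ (coeff h i +ℤ coeff k i)
    ≡⟨ interchange (coeff f i) (coeff g i) (coeff h i) (coeff k i) ⟩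
  (coeff f i +ℤ coeff h i) +ℤ (coeff g i +ℤ coeff k i)
    ≡⟨ cong₂ _+ℤ_ (coeff-+P f h i) (coeff-+P g k i) ⟨
  coeff (f +P h) i +ℤ coeff (g +P k) i
    ≡⟨ coeff-+P (f +P h) (g +P k) i ⟨
  coeff ((f +P h) +P (g +P k)) i
    ∎
  where
  open ≡.≡-Reasoning
  interchange : ∀ a b c d → (a +ℤ b) +ℤ (c +ℤ d) ≡ (a +ℤ c) +ℤ (b +ℤ d)
  interchange = ℤ-Solver.solve-∀

scale-cong : ∀ {c d f g} → c ≡ d → f ≋ g → scale c f ≋ scale d g
scale-cong {c} {d} {f} {g} c≡d f≋g = mk≋ λ i → begin
  coeff (scale c f) i    ≡⟨ coeff-scale c f i ⟩
  c *ℤ coeff f i         ≡⟨ cong₂ _*ℤ_ c≡d (coeff-≡ f≋g i) ⟩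
  d *ℤ coeff g i         ≡⟨ coeff-scale d g i ⟨
  coeff (scale d g) i    ∎
  where open ≡.≡-Reasoning

negP-cong : ∀ {f g} → f ≋ g → negP f ≋ negP g
negP-cong = scale-cong refl

negP-inverseˡ : ∀ f → negP f +P f ≋ []
negP-inverseˡ f = mk≋ λ i → begin
  coeff (negP f +P f) i               ≡⟨ coeff-+P (negP f) f i ⟩
  coeff (negP f) i +ℤ coeff f i       ≡⟨ cong (_+ℤ coeff f i) (coeff-scale (- 1ℤ) f i) ⟩
  - 1ℤ *ℤ coeff f i +ℤ coeff f i      ≡⟨ cancel (coeff f i) ⟩
  0ℤ                                  ∎
  where
  open ≡.≡-Reasoning
  cancel : ∀ a → - 1ℤ *ℤ a +ℤ a ≡ 0ℤ
  cancel = ℤ-Solver.solve-∀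

scale-distribˡ : ∀ c f g → scale c (f +P g) ≋ scale c f +P scale c g
scale-distribˡ c f g = mk≋ λ i → begin
  coeff (scale c (f +P g)) i                    ≡⟨ coeff-scale c (f +P g) i ⟩
  c *ℤ coeff (f +P g) i                         ≡⟨ cong (c *ℤ_) (coeff-+P f g i) ⟩
  c *ℤ (coeff f i +ℤ coeff g i)                 ≡⟨ ℤₚ.*-distribˡ-+ c (coeff f i) (coeff g i) ⟩
  c *ℤ coeff f i +ℤ c *ℤ coeff g i              ≡⟨ cong₂ _+ℤ_ (coeff-scale c f i) (coeff-scale c g i) ⟨
  coeff (scale c f) i +ℤ coeff (scale c g) i    ≡⟨ coeff-+P (scale c f) (scale c g) i ⟨
  coeff (scale c f +P scale c g) i              ∎
  where open ≡.≡-Reasoning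

scale-distribʳ : ∀ c d f → scale (c +ℤ d) f ≋ scale c f +P scale d f
scale-distribʳ c d f = mk≋ λ i → begin
  coeff (scale (c +ℤ d) f) i                    ≡⟨ coeff-scale (c +ℤ d) f i ⟩
  (c +ℤ d) *ℤ coeff f i                         ≡⟨ ℤₚ.*-distribʳ-+ (coeff f i) c d ⟩
  c *ℤ coeff f i +ℤ d *ℤ coeff f i              ≡⟨ cong₂ _+ℤ_ (coeff-scale c f i) (coeff-scale d f i) ⟨
  coeff (scale c f) i +ℤ coeff (scale d f) i    ≡⟨ coeff-+P (scale c f) (scale d f) i ⟨
  coeff (scale c f +P scale d f) i              ∎
  where open ≡.≡-Reasoning

scale-scale : ∀ c d f → scale c (scale d f) ≋ scale (c *ℤ d) f
scale-scale c d f = mk≋ λ i → begin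
  coeff (scale c (scale d f)) i    ≡⟨ coeff-scale c (scale d f) i ⟩
  c *ℤ coeff (scale d f) i         ≡⟨ cong (c *ℤ_) (coeff-scale d f i) ⟩
  c *ℤ (d *ℤ coeff f i)            ≡⟨ ℤₚ.*-assoc c d (coeff f i) ⟨
  (c *ℤ d) *ℤ coeff f i            ≡⟨ coeff-scale (c *ℤ d) f i ⟨
  coeff (scale (c *ℤ d) f) i       ∎
  where open ≡.≡-Reasoning

scale-zero : ∀ f → scale 0ℤ f ≋ []
scale-zero f = mk≋ λ i → ≡.trans (coeff-scale 0ℤ f i) (ℤₚ.*-zeroˡ (coeff f i))

scale-identity : ∀ f → scale 1ℤ f ≋ f
scale-identity f = mk≋ λ i → ≡.trans (coeff-scale 1ℤ f i) (ℤₚ.*-identityˡ (coeff f i))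

0∷-*P : ∀ f g → (0ℤ ∷ f) *P g ≋ 0ℤ ∷ (f *P g)
0∷-*P f g = +P-cong (scale-zero g) ≋-refl

*P-zeroʳ : ∀ f → f *P [] ≋ []
*P-zeroʳ []      = ≋-refl
*P-zeroʳ (a ∷ f) = mk≋ λ { zero → refl ; (suc i) → coeff-≡ (*P-zeroʳ f) i }

*P-zeroˡ : ∀ {f} g → f ≋ [] → f *P g ≋ []
*P-zeroˡ {[]}    g f≋[] = ≋-refl
*P-zeroˡ {a ∷ f} g a∷f≋[] = begin
  scale a g +P (0ℤ ∷ f *P g)
    ≈⟨ +P-cong (scale-cong (coeff-≡ a∷f≋[] zero) ≋-refl) (∷-cong refl (*P-zeroˡ g f≋[])) ⟩
  scale 0ℤ g +P (0ℤ ∷ [])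
    ≈⟨ +P-congˡ (0ℤ ∷ []) (scale-zero g) ⟩
  0ℤ ∷ []
    ≈⟨ mk≋ (λ { zero → refl ; (suc i) → refl }) ⟩
  []
    ∎
  where
  open ≋-Reasoning
  f≋[] : f ≋ []
  f≋[] = mk≋ λ i → coeff-≡ a∷f≋[] (suc i)

*P-congˡ : ∀ {f f′} g → f ≋ f′ → f *P g ≋ f′ *P g
*P-congˡ {[]}    {f′}      g []≋f′ = ≋-sym (*P-zeroˡ g (≋-sym []≋f′))
*P-congˡ {a ∷ f} {[]}      g f≋[]  = *P-zeroˡ g f≋[]
*P-congˡ {a ∷ f} {b ∷ f′}  g f≋f′  =
  +P-cong (scale-cong (coeff-≡ f≋f′ zero) ≋-refl) (∷-cong refl (*P-congˡ g (∷-injective f≋f′)))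

*P-congʳ : ∀ f {g g′} → g ≋ g′ → f *P g ≋ f *P g′
*P-congʳ []      g≋g′ = ≋-refl
*P-congʳ (a ∷ f) g≋g′ = +P-cong (scale-cong refl g≋g′) (∷-cong refl (*P-congʳ f g≋g′))

*P-cong : ∀ {f f′ g g′} → f ≋ f′ → g ≋ g′ → f *P g ≋ f′ *P g′
*P-cong {f′ = f′} {g = g} f≋f′ g≋g′ = ≋-trans (*P-congˡ g f≋f′) (*P-congʳ f′ g≋g′)

*P-distribʳ : ∀ h f g → (f +P g) *P h ≋ f *P h +P g *P h
*P-distribʳ h []      g       = ≋-refl
*P-distribʳ h (a ∷ f) []      = ≋-sym (+P-identityʳ _)
*P-distribʳ h (a ∷ f) (b ∷ g) = begin
  scale (a +ℤ b) h +P (0ℤ ∷ (f +P g) *P h)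
    ≈⟨ +P-cong (scale-distribʳ a b h) (∷-cong refl (*P-distribʳ h f g)) ⟩
  (scale a h +P scale b h) +P ((0ℤ ∷ f *P h) +P (0ℤ ∷ g *P h))
    ≈⟨ +P-interchange (scale a h) (scale b h) (0ℤ ∷ f *P h) (0ℤ ∷ g *P h) ⟩
  (scale a h +P (0ℤ ∷ f *P h)) +P (scale b h +P (0ℤ ∷ g *P h))
    ∎
  where open ≋-Reasoning

*P-distribˡ : ∀ f g h → f *P (g +P h) ≋ f *P g +P f *P h
*P-distribˡ []      g h = ≋-refl
*P-distribˡ (a ∷ f) g h = begin
  scale a (g +P h) +P (0ℤ ∷ f *P (g +P h))
    ≈⟨ +P-cong (scale-distribˡ a g h) (∷-cong refl (*P-distribˡ f g h)) ⟩
  (scale a g +P scale a h) +P ((0ℤ ∷ f *P g) +P (0ℤ ∷ f *P h))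
    ≈⟨ +P-interchange (scale a g) (scale a h) (0ℤ ∷ f *P g) (0ℤ ∷ f *P h) ⟩
  (scale a g +P (0ℤ ∷ f *P g)) +P (scale a h +P (0ℤ ∷ f *P h))
    ∎
  where open ≋-Reasoning

scale-*P : ∀ c f g → scale c (f *P g) ≋ scale c f *P g
scale-*P c []      g = ≋-refl
scale-*P c (a ∷ f) g = begin
  scale c (scale a g +P (0ℤ ∷ f *P g))
    ≈⟨ scale-distribˡ c (scale a g) (0ℤ ∷ f *P g) ⟩
  scale c (scale a g) +P (c *ℤ 0ℤ ∷ scale c (f *P g))
    ≈⟨ +P-cong (scale-scale c a g) (∷-cong (ℤₚ.*-zeroʳ c) (scale-*P c f g)) ⟩
  scale (c *ℤ a) g +P (0ℤ ∷ scale c f *P g)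
    ∎
  where open ≋-Reasoning

*P-assoc : ∀ f g h → (f *P g) *P h ≋ f *P (g *P h)
*P-assoc []      g h = ≋-refl
*P-assoc (a ∷ f) g h = begin
  (scale a g +P (0ℤ ∷ f *P g)) *P h
    ≈⟨ *P-distribʳ h (scale a g) (0ℤ ∷ f *P g) ⟩
  scale a g *P h +P (0ℤ ∷ f *P g) *P h
    ≈⟨ +P-cong (≋-sym (scale-*P a g h)) (≋-trans (0∷-*P (f *P g) h) (∷-cong refl (*P-assoc f g h))) ⟩
  scale a (g *P h) +P (0ℤ ∷ f *P (g *P h))
    ∎
  where open ≋-Reasoning

*P-∷ʳ : ∀ f b g → f *P (b ∷ g) ≋ scale b f +P (0ℤ ∷ f *P g)
*P-∷ʳ []      b g = mk≋ λ { zero → refl ; (suc i) → refl }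
*P-∷ʳ (a ∷ f) b g = ∷-cong ab≡ba (begin
  scale a g +P f *P (b ∷ g)                       ≈⟨ +P-cong ≋-refl (*P-∷ʳ f b g) ⟩
  scale a g +P (scale b f +P (0ℤ ∷ f *P g))       ≈⟨ +P-assoc (scale a g) (scale b f) _ ⟨
  (scale a g +P scale b f) +P (0ℤ ∷ f *P g)       ≈⟨ +P-cong (+P-comm (scale a g) (scale b f)) ≋-refl ⟩
  (scale b f +P scale a g) +P (0ℤ ∷ f *P g)       ≈⟨ +P-assoc (scale b f) (scale a g) _ ⟩
  scale b f +P (scale a g +P (0ℤ ∷ f *P g))       ∎)
  where
  open ≋-Reasoning
  ab≡ba : a *ℤ b +ℤ 0ℤ ≡ b *ℤ a +ℤ 0ℤ
  ab≡ba = cong (_+ℤ 0ℤ) (ℤₚ.*-comm a b)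

*P-comm : ∀ f g → f *P g ≋ g *P f
*P-comm []      g = ≋-sym (*P-zeroʳ g)
*P-comm (a ∷ f) g = ≋-trans (+P-cong ≋-refl (∷-cong refl (*P-comm f g))) (≋-sym (*P-∷ʳ g a f))

*P-identityˡ : ∀ f → oneP *P f ≋ f
*P-identityˡ f =
  ≋-trans (+P-cong (scale-identity f) (mk≋ λ { zero → refl ; (suc i) → refl })) (+P-identityʳ f)

*P-identityʳ : ∀ f → f *P oneP ≋ f
*P-identityʳ f = ≋-trans (*P-comm f oneP) (*P-identityˡ f)

ℤ[X] : CommutativeRing 0ℓ 0ℓ
ℤ[X] = record
  { Carrier = Poly ; _≈_ = _≋_ ; _+_ = _+P_ ; _*_ = _*P_ ; -_ = negP ; 0# = [] ; 1# = oneP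
  ; isCommutativeRing = record
    { isRing = record
      { +-isAbelianGroup = record
        { isGroup = record
          { isMonoid = record
            { isSemigroup = record
              { isMagma = record { isEquivalence = Setoid.isEquivalence ≋-setoid ; ∙-cong = +P-cong }
              ; assoc = +P-assoc }
            ; identity = (λ _ → ≋-refl) , +P-identityʳ }
          ; inverse = negP-inverseˡ , λ f → ≋-trans (+P-comm f (negP f)) (negP-inverseˡ f)
          ; ⁻¹-cong = scale-cong refl }
        ; comm = +P-comm }
      ; *-cong = *P-cong
      ; *-assoc = *P-assoc
      ; *-identity = *P-identityˡ , *P-identityʳ
      ; distrib = *P-distribˡ , *P-distribʳ }
    ; *-comm = *P-comm } }

[]≋? : ∀ f → Maybe ([] ≋ f)
[]≋? []               = just ≋-refl
[]≋? (+ zero ∷ f)     = map (λ []≋f → mk≋ λ { zero → refl ; (suc i) → coeff-≡ []≋f i }) ([]≋? f)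
[]≋? (+ suc _ ∷ _)    = nothing
[]≋? (-[1+ _ ] ∷ _)   = nothing

ℤ[X]-almost : AlmostCommutativeRing 0ℓ 0ℓ
ℤ[X]-almost = fromCommutativeRing ℤ[X] []≋?

open CommutativeRing ℤ[X] using (*-commutativeSemigroup; *-monoid; semiring)
open import Algebra.Properties.CommutativeSemigroup.Divisibility *-commutativeSemigroup
open import Algebra.Properties.Monoid.Divisibility *-monoid using (∣ʳ-refl; ∣ʳ-reflexive)
open import Algebra.Properties.Semiring.Divisibility semiring using (_∣0)

-- Divisibility by 1 + X^a

1+X^_ : ℕ → Poly
1+X^ a = oneP +P X^ a

1-X^_ : ℕ → Poly
1-X^ e = oneP +P negP (X^ e)

X^-+ : ∀ a b → X^ (a + b) ≋ X^ a *P X^ b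
X^-+ zero    b = ≋-sym (*P-identityˡ (X^ b))
X^-+ (suc a) b = ≋-trans (∷-cong refl (X^-+ a b)) (≋-sym (0∷-*P (X^ a) (X^ b)))

1-X^-+ : ∀ m n → 1-X^ (m + n) ≋ oneP +P negP (X^ m *P X^ n)
1-X^-+ m n = +P-congʳ oneP (negP-cong (X^-+ m n))

coeff-X^*P-+ : ∀ a f i → coeff (X^ a *P f) (a + i) ≡ coeff f i
coeff-X^*P-+ zero    f i = coeff-≡ (*P-identityˡ f) i
coeff-X^*P-+ (suc a) f i = ≡.trans (coeff-≡ (0∷-*P (X^ a) f) (suc (a + i))) (coeff-X^*P-+ a f i)

coeff-X^*P-< : ∀ a f {i} → i < a → coeff (X^ a *P f) i ≡ 0ℤ
coeff-X^*P-< (suc a) f {zero}  _         = coeff-≡ (0∷-*P (X^ a) f) zero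
coeff-X^*P-< (suc a) f {suc i} (s≤s i<a) = ≡.trans (coeff-≡ (0∷-*P (X^ a) f) (suc i)) (coeff-X^*P-< a f i<a)

∣ℤ-0 : ∀ d → d ∣ℤ 0ℤ
∣ℤ-0 d = divides 0ℤ (≡.sym (ℤₚ.*-zeroˡ d))

-- With c = (1 + X^a) f we have coeff f i = c i - coeff f (i - a), so d-divisibility climbs up from the c i.
1+X^-content : ∀ a .{{_ : ℕ.NonZero a}} d f → (∀ i → d ∣ℤ coeff (1+X^ a *P f) i) → ∀ i → d ∣ℤ coeff f i
1+X^-content a d f d∣c = <-rec _ step
  where
  c≡ : ∀ i → coeff (1+X^ a *P f) i ≡ coeff f i +ℤ coeff (X^ a *P f) i
  c≡ i = ≡.trans (coeff-≡ (≋-trans (*P-distribʳ f oneP (X^ a)) (+P-congˡ (X^ a *P f) (*P-identityˡ f))) i)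
                 (coeff-+P f (X^ a *P f) i)
  step : ∀ i → (∀ {j} → j < i → d ∣ℤ coeff f j) → d ∣ℤ coeff f i
  step i rec = subst (d ∣ℤ_) recover (∣m∣n⇒∣m-n (d∣c i) shifted)
    where
    recover : coeff (1+X^ a *P f) i -ℤ coeff (X^ a *P f) i ≡ coeff f i
    recover = ≡.trans (cong (_-ℤ coeff (X^ a *P f) i) (c≡ i)) (+-cancel (coeff f i) _)
      where
      +-cancel : ∀ x y → (x +ℤ y) -ℤ y ≡ x
      +-cancel = ℤ-Solver.solve-∀
    shifted : d ∣ℤ coeff (X^ a *P f) i
    shifted with i <? a
    ... | yes i<a = subst (d ∣ℤ_) (≡.sym (coeff-X^*P-< a f i<a)) (∣ℤ-0 d)
    ... | no  i≮a = subst (λ j → d ∣ℤ coeff (X^ a *P f) j) i≡a+t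
                      (subst (d ∣ℤ_) (≡.sym (coeff-X^*P-+ a f t)) (rec t<i))
      where
      t = i ∸ a
      i≡a+t : a + t ≡ i
      i≡a+t = ℕₚ.m+[n∸m]≡n (ℕₚ.≮⇒≥ i≮a)
      t<i : t < i
      t<i = ℕₚ.<-≤-trans (ℕₚ.m<n+m t (ℕ.>-nonZero⁻¹ a)) (ℕₚ.≤-reflexive i≡a+t)

∣coeff⇒≋scale : ∀ d f → (∀ i → d ∣ℤ coeff f i) → ∃ λ h → f ≋ scale d h
∣coeff⇒≋scale d []      _   = [] , ≋-refl
∣coeff⇒≋scale d (a ∷ f) d∣f with ∣coeff⇒≋scale d f (λ i → d∣f (suc i)) | d∣f zero
... | h , f≋dh | divides q a≡qd = q ∷ h , ∷-cong (≡.trans a≡qd (ℤₚ.*-comm q d)) f≋dh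

scale-cancelˡ : ∀ d {f g} .{{_ : NonZero d}} → scale d f ≋ scale d g → f ≋ g
scale-cancelˡ d {f} {g} df≋dg = mk≋ λ i → ℤₚ.*-cancelˡ-≡ d (coeff f i) (coeff g i)
  (≡.trans (≡.sym (coeff-scale d f i)) (≡.trans (coeff-≡ df≋dg i) (coeff-scale d g i)))

1+X^-cancelˡ : ∀ a .{{_ : ℕ.NonZero a}} {f g} → 1+X^ a *P f ≋ 1+X^ a *P g → f ≋ g
1+X^-cancelˡ a {f} {g} af≋ag = begin
  f                       ≈⟨ split f g ⟩
  (f +P negP g) +P g      ≈⟨ +P-congˡ g f-g≋[] ⟩
  g                       ∎
  where
  open ≋-Reasoning
  split : ∀ f g → f ≋ (f +P negP g) +P g
  split = solve-∀ ℤ[X]-almost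
  distrib : ∀ p f g → p *P (f +P negP g) ≋ p *P f +P negP (p *P g)
  distrib = solve-∀ ℤ[X]-almost
  a[f-g]≋[] : 1+X^ a *P (f +P negP g) ≋ []
  a[f-g]≋[] = begin
    1+X^ a *P (f +P negP g)          ≈⟨ distrib (1+X^ a) f g ⟩
    1+X^ a *P f +P negP (1+X^ a *P g)  ≈⟨ +P-congˡ (negP (1+X^ a *P g)) af≋ag ⟩
    1+X^ a *P g +P negP (1+X^ a *P g)  ≈⟨ +P-comm (1+X^ a *P g) (negP (1+X^ a *P g)) ⟩
    negP (1+X^ a *P g) +P 1+X^ a *P g  ≈⟨ negP-inverseˡ (1+X^ a *P g) ⟩
    []                                 ∎
  f-g≋[] : f +P negP g ≋ []
  f-g≋[] = mk≋ λ i → 0∣⇒≡0 (1+X^-content a 0ℤ (f +P negP g)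
    (λ j → divides 0ℤ (coeff-≡ a[f-g]≋[] j)) i)

1+X^∣scale⇒∣ : ∀ a d {f} .{{_ : ℕ.NonZero a}} .{{_ : NonZero d}} → 1+X^ a ∣ scale d f → 1+X^ a ∣ f
1+X^∣scale⇒∣ a d {f} (q , qa≋df) = h , scale-cancelˡ d (begin
  scale d (h *P 1+X^ a)     ≈⟨ scale-*P d h (1+X^ a) ⟩
  scale d h *P 1+X^ a       ≈⟨ *P-congˡ (1+X^ a) q≋dh ⟨
  q *P 1+X^ a               ≈⟨ qa≋df ⟩
  scale d f                 ∎)
  where
  open ≋-Reasoning
  d∣aq : ∀ i → d ∣ℤ coeff (1+X^ a *P q) i
  d∣aq i = divides (coeff f i) (≡.trans (coeff-≡ (≋-trans (*P-comm (1+X^ a) q) qa≋df) i)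
                                 (≡.trans (coeff-scale d f i) (ℤₚ.*-comm d (coeff f i))))
  h = proj₁ (∣coeff⇒≋scale d q (1+X^-content a d q d∣aq))
  q≋dh = proj₂ (∣coeff⇒≋scale d q (1+X^-content a d q d∣aq))

∣f∣g⇒∣f+g : ∀ {d f g} → d ∣ f → d ∣ g → d ∣ f +P g
∣f∣g⇒∣f+g {d} (p , pd≋f) (q , qd≋g) = p +P q , ≋-trans (*P-distribʳ d p q) (+P-cong pd≋f qd≋g)

module GcdClosed {P : ℕ → Set} (0∈P : P 0) (+-closed : ∀ {m n} → P m → P n → P (m + n))
                 (∸-closed : ∀ {d n} → P n → P (d + n) → P d) where

  *-closed : ∀ t {n} → P n → P (t * n)
  *-closed zero    _  = 0∈P
  *-closed (suc t) Pn = +-closed Pn (*-closed t Pn)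

  gcd-closed : ∀ {m n} → P m → P n → P (gcd m n)
  gcd-closed {m} {n} Pm Pn with Bézout.lemma m n
  ... | Bézout.result d g (Bézout.+- x y d+yn≡xm) =
    subst P (GCD.unique g (gcd-GCD m n)) (∸-closed (*-closed y Pn) (subst P (≡.sym d+yn≡xm) (*-closed x Pm)))
  ... | Bézout.result d g (Bézout.-+ x y d+xm≡yn) =
    subst P (GCD.unique g (gcd-GCD m n)) (∸-closed (*-closed x Pm) (subst P (≡.sym d+xm≡yn) (*-closed y Pn)))

double : ℕ → ℕ
double zero    = zero
double (suc k) = suc (suc (double k))

odd-coprime-2 : ∀ k → Coprime (suc (double k)) 2
odd-coprime-2 zero    = 1-coprimeTo 2
odd-coprime-2 (suc k) = coprime-+ (odd-coprime-2 k)

-- The exponents e with (1 + X^a) ∣ (1 - X^e) f contain 0 and 2a and are closed under sums and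
-- differences; so with an odd exponent b they contain gcd b 2a, a divisor of a, hence a itself.
module _ (a : ℕ) (f : Poly) where

  ∣[1-X^0]* : 1+X^ a ∣ 1-X^ 0 *P f
  ∣[1-X^0]* = ∣-respʳ-≈ (≋-sym (1-1≋0 f)) (1+X^ a ∣0)
    where
    1-1≋0 : ∀ f → (oneP +P negP oneP) *P f ≋ []
    1-1≋0 = solve-∀ ℤ[X]-almost

  ∣[1-X^a+a]* : 1+X^ a ∣ 1-X^ (a + a) *P f
  ∣[1-X^a+a]* = ∣-respʳ-≈ (≋-sym (begin
    1-X^ (a + a) *P f                           ≈⟨ *P-congˡ f (1-X^-+ a a) ⟩
    (oneP +P negP (X^ a *P X^ a)) *P f          ≈⟨ difference-of-squares (X^ a) f ⟩
    1+X^ a *P (1-X^ a *P f)                     ∎)) (x∣xy (1+X^ a) (1-X^ a *P f))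
    where
    open ≋-Reasoning
    difference-of-squares : ∀ u f → (oneP +P negP (u *P u)) *P f ≋ (oneP +P u) *P ((oneP +P negP u) *P f)
    difference-of-squares = solve-∀ ℤ[X]-almost

  ∣[1-X^-+]* : ∀ m n → 1+X^ a ∣ 1-X^ m *P f → 1+X^ a ∣ 1-X^ n *P f → 1+X^ a ∣ 1-X^ (m + n) *P f
  ∣[1-X^-+]* m n ∣m ∣n = ∣-respʳ-≈ (≋-sym (begin
    1-X^ (m + n) *P f                                  ≈⟨ *P-congˡ f (1-X^-+ m n) ⟩
    (oneP +P negP (X^ m *P X^ n)) *P f                 ≈⟨ telescope (X^ m) (X^ n) f ⟩
    1-X^ m *P f +P X^ m *P (1-X^ n *P f)               ∎)) (∣f∣g⇒∣f+g ∣m (x∣ʳy⇒x∣ʳzy (X^ m) ∣n))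
    where
    open ≋-Reasoning
    telescope : ∀ u v f → (oneP +P negP (u *P v)) *P f ≋ (oneP +P negP u) *P f +P u *P ((oneP +P negP v) *P f)
    telescope = solve-∀ ℤ[X]-almost

  ∣[1-X^-∸]* : ∀ d n → 1+X^ a ∣ 1-X^ n *P f → 1+X^ a ∣ 1-X^ (d + n) *P f → 1+X^ a ∣ 1-X^ d *P f
  ∣[1-X^-∸]* d n ∣n ∣d+n = ∣-respʳ-≈ (≋-sym (begin
    1-X^ d *P f                                                ≈⟨ telescope (X^ d) (X^ n) f ⟩
    (oneP +P negP (X^ d *P X^ n)) *P f +P negP (X^ d) *P (1-X^ n *P f)
      ≈⟨ +P-congˡ (negP (X^ d) *P (1-X^ n *P f)) (*P-congˡ f (1-X^-+ d n)) ⟨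
    1-X^ (d + n) *P f +P negP (X^ d) *P (1-X^ n *P f)         ∎)) (∣f∣g⇒∣f+g ∣d+n (x∣ʳy⇒x∣ʳzy (negP (X^ d)) ∣n))
    where
    open ≋-Reasoning
    telescope : ∀ u v f → (oneP +P negP u) *P f ≋ (oneP +P negP (u *P v)) *P f +P negP u *P ((oneP +P negP v) *P f)
    telescope = solve-∀ ℤ[X]-almost

  ∣[1-X^odd]*⇒∣[1-X^a]* : ∀ k → 1+X^ a ∣ 1-X^ (suc (double k)) *P f → 1+X^ a ∣ 1-X^ a *P f
  ∣[1-X^odd]*⇒∣[1-X^a]* k ∣odd = subst (λ e → 1+X^ a ∣ 1-X^ e *P f) (≡.sym (ℕᵈ._∣_.equality g∣a))
    (*-closed (ℕᵈ.quotient g∣a) (gcd-closed {b} {a + a} ∣odd ∣[1-X^a+a]*))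
    where
    open GcdClosed {λ e → 1+X^ a ∣ 1-X^ e *P f} ∣[1-X^0]* (λ {m} {n} → ∣[1-X^-+]* m n) (λ {d} {n} → ∣[1-X^-∸]* d n)
    b = suc (double k)
    g∣a : gcd b (a + a) ℕᵈ.∣ a
    g∣a = coprime-factors (odd-coprime-2 k)
      ( ℕᵈ.∣-trans (gcd[m,n]∣m b (a + a)) (ℕᵈ.m∣m*n a)
      , subst (gcd b (a + a) ℕᵈ.∣_) (cong (λ n → a + n) (≡.sym (ℕₚ.+-identityʳ a))) (gcd[m,n]∣n b (a + a)))

  ∣[1-X^a]*⇒∣ : .{{_ : ℕ.NonZero a}} → 1+X^ a ∣ 1-X^ a *P f → 1+X^ a ∣ f
  ∣[1-X^a]*⇒∣ ∣[1-X^a]f = 1+X^∣scale⇒∣ a (+ 2) (∣-respʳ-≈ 2f (∣f∣g⇒∣f+g ∣[1-X^a]f (x∣xy (1+X^ a) f)))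
    where
    sum : ∀ u f → (oneP +P negP u) *P f +P (oneP +P u) *P f ≋ f +P f
    sum = solve-∀ ℤ[X]-almost
    2f : 1-X^ a *P f +P 1+X^ a *P f ≋ scale (+ 2) f
    2f = ≋-trans (sum (X^ a) f) (mk≋ λ i →
      ≡.trans (coeff-+P f f i) (≡.trans (twice (coeff f i)) (≡.sym (coeff-scale (+ 2) f i))))
      where
      twice : ∀ x → x +ℤ x ≡ + 2 *ℤ x
      twice = ℤ-Solver.solve-∀

∏1+X^_ : ℕ → Poly
∏1+X^ zero    = oneP
∏1+X^ (suc s) = ∏1+X^ s *P 1+X^ (suc s)

∏1+X^-cancelˡ : ∀ s f g → ∏1+X^ s *P f ≋ ∏1+X^ s *P g → f ≋ g
∏1+X^-cancelˡ zero    f g 1f≋1g = ≋-trans (≋-sym (*P-identityˡ f)) (≋-trans 1f≋1g (*P-identityˡ g))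
∏1+X^-cancelˡ (suc s) f g Pf≋Pg =
  1+X^-cancelˡ (suc s) (∏1+X^-cancelˡ s (1+X^ (suc s) *P f) (1+X^ (suc s) *P g) (begin
  ∏1+X^ s *P (1+X^ (suc s) *P f)    ≈⟨ *P-assoc (∏1+X^ s) (1+X^ (suc s)) f ⟨
  ∏1+X^ (suc s) *P f                ≈⟨ Pf≋Pg ⟩
  ∏1+X^ (suc s) *P g                ≈⟨ *P-assoc (∏1+X^ s) (1+X^ (suc s)) g ⟩
  ∏1+X^ s *P (1+X^ (suc s) *P g)    ∎))
  where open ≋-Reasoning

∏1+X^-∣-cancelˡ : ∀ s f g → ∏1+X^ s *P f ∣ ∏1+X^ s *P g → f ∣ g
∏1+X^-∣-cancelˡ s f g (q , qPf≋Pg) = q , ∏1+X^-cancelˡ s (q *P f) g (≋-trans (swap (∏1+X^ s) q f) qPf≋Pg)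
  where
  swap : ∀ p q f → p *P (q *P f) ≋ q *P (p *P f)
  swap = solve-∀ ℤ[X]-almost

-- Once ∏1+X^ s ∣ Z = g ∏1+X^ s, one more factor 1 + X^(s+1) is a question about g alone.
module _ (s : ℕ) (Z g : Poly) (g∏≋Z : g *P ∏1+X^ s ≋ Z) where

  ∏1+X^suc∣[1-X^e]Z⇒ : ∀ e → ∏1+X^ (suc s) ∣ 1-X^ e *P Z → 1+X^ (suc s) ∣ 1-X^ e *P g
  ∏1+X^suc∣[1-X^e]Z⇒ e ∣eZ = ∏1+X^-∣-cancelˡ s (1+X^ (suc s)) (1-X^ e *P g) (∣-respʳ-≈ [1-X^e]Z≋ ∣eZ)
    where
    rearrange : ∀ u g p → u *P (g *P p) ≋ p *P (u *P g)
    rearrange = solve-∀ ℤ[X]-almost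
    [1-X^e]Z≋ : 1-X^ e *P Z ≋ ∏1+X^ s *P (1-X^ e *P g)
    [1-X^e]Z≋ = ≋-trans (*P-congʳ (1-X^ e) (≋-sym g∏≋Z)) (rearrange (1-X^ e) g (∏1+X^ s))

  1+X^suc∣g⇒ : 1+X^ (suc s) ∣ g → ∏1+X^ (suc s) ∣ Z
  1+X^suc∣g⇒ ∣g = ∣-respʳ-≈ (≋-trans (*P-comm (∏1+X^ s) g) g∏≋Z) (x∣y⇒zx∣zy (∏1+X^ s) ∣g)

∏1+X^-extend-odd : ∀ s Z k → ∏1+X^ s ∣ Z → ∏1+X^ (suc s) ∣ 1-X^ (suc (double k)) *P Z → ∏1+X^ (suc s) ∣ Z
∏1+X^-extend-odd s Z k (g , g∏≋Z) ∣oddZ = 1+X^suc∣g⇒ s Z g g∏≋Z (∣[1-X^a]*⇒∣ (suc s) g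
  (∣[1-X^odd]*⇒∣[1-X^a]* (suc s) g k (∏1+X^suc∣[1-X^e]Z⇒ s Z g g∏≋Z (suc (double k)) ∣oddZ)))

∏1+X^-extend-+ : ∀ s Z b c → b + c ≡ suc s → ∏1+X^ s ∣ Z →
                 ∏1+X^ (suc s) ∣ 1-X^ b *P Z → ∏1+X^ (suc s) ∣ 1-X^ c *P Z → ∏1+X^ (suc s) ∣ Z
∏1+X^-extend-+ s Z b c b+c≡a (g , g∏≋Z) ∣bZ ∣cZ = 1+X^suc∣g⇒ s Z g g∏≋Z (∣[1-X^a]*⇒∣ (suc s) g
  (subst (λ e → 1+X^ (suc s) ∣ 1-X^ e *P g) b+c≡a
    (∣[1-X^-+]* (suc s) g b c (∏1+X^suc∣[1-X^e]Z⇒ s Z g g∏≋Z b ∣bZ) (∏1+X^suc∣[1-X^e]Z⇒ s Z g g∏≋Z c ∣cZ))))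

-- Gaussian binomials

qbinom : ℕ → ℕ → Poly
qbinom zero    M       = oneP
qbinom (suc K) zero    = oneP
qbinom (suc K) (suc M) = qbinom K (suc M) +P X^ (suc K) *P qbinom (suc K) M

qbinom-zeroʳ : ∀ K → qbinom K zero ≡ oneP
qbinom-zeroʳ zero    = refl
qbinom-zeroʳ (suc K) = refl

gauss-above : ∀ n k → gauss n (suc (n + k)) ≋ []
gauss-above zero    k = ≋-refl
gauss-above (suc n) k = begin
  gauss n (suc (n + k)) +P X^ (suc (suc (n + k))) *P gauss n (suc (suc n + k))
    ≈⟨ +P-congˡ (X^ (suc (suc (n + k))) *P gauss n (suc (suc n + k))) (gauss-above n k) ⟩
  X^ (suc (suc (n + k))) *P gauss n (suc (suc n + k))
    ≡⟨ cong (λ j → X^ (suc (suc (n + k))) *P gauss n (suc j)) (ℕₚ.+-suc n k) ⟨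
  X^ (suc (suc (n + k))) *P gauss n (suc (n + suc k))
    ≈⟨ *P-congʳ (X^ (suc (suc (n + k)))) (gauss-above n (suc k)) ⟩
  X^ (suc (suc (n + k))) *P []
    ≈⟨ *P-zeroʳ (X^ (suc (suc (n + k)))) ⟩
  []
    ∎
  where open ≋-Reasoning

gauss-diag : ∀ n → gauss n n ≋ oneP
gauss-diag zero    = ≋-refl
gauss-diag (suc n) = begin
  gauss n n +P X^ (suc n) *P gauss n (suc n)    ≈⟨ +P-cong (gauss-diag n) (*P-congʳ (X^ (suc n)) above) ⟩
  oneP +P X^ (suc n) *P []                     ≈⟨ +P-congʳ oneP (*P-zeroʳ (X^ (suc n))) ⟩
  oneP                                          ∎
  where
  open ≋-Reasoning
  above : gauss n (suc n) ≋ []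
  above = ≋-trans (≡⇒≋ (cong (λ j → gauss n (suc j)) (≡.sym (ℕₚ.+-identityʳ n)))) (gauss-above n 0)

gauss≋qbinom : ∀ K M → gauss (K + M) K ≋ qbinom K M
gauss≋qbinom zero    zero    = ≋-refl
gauss≋qbinom zero    (suc M) = ≋-refl
gauss≋qbinom (suc K) zero    = ≋-trans (≡⇒≋ (cong (λ n → gauss n (suc K)) (ℕₚ.+-identityʳ (suc K)))) (gauss-diag (suc K))
gauss≋qbinom (suc K) (suc M) = +P-cong (gauss≋qbinom K (suc M)) (*P-congʳ (X^ (suc K)) (begin
  gauss (K + suc M) (suc K)     ≡⟨ cong (λ n → gauss n (suc K)) (ℕₚ.+-suc K M) ⟩
  gauss (suc K + M) (suc K)     ≈⟨ gauss≋qbinom (suc K) M ⟩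
  qbinom (suc K) M              ∎))
  where open ≋-Reasoning

absorbˡ : ∀ K M → 1-X^ (suc K) *P qbinom (suc K) M ≋ 1-X^ (suc (K + M)) *P qbinom K M
absorbʳ : ∀ K M → 1-X^ (suc M) *P qbinom K (suc M) ≋ 1-X^ (suc (K + M)) *P qbinom K M

absorbˡ K zero    = ≡⇒≋ (cong₂ (λ n G → 1-X^ (suc n) *P G) (≡.sym (ℕₚ.+-identityʳ K)) (≡.sym (qbinom-zeroʳ K)))
absorbˡ K (suc M) = begin
  1-X^ (suc K) *P (P +P u *P R)
    ≈⟨ expand u P R ⟩
  1-X^ (suc K) *P P +P u *P (1-X^ (suc K) *P R)
    ≈⟨ +P-congʳ (1-X^ (suc K) *P P) (*P-congʳ u (absorbˡ K M)) ⟩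
  1-X^ (suc K) *P P +P u *P (1-X^ (suc (K + M)) *P Q)
    ≈⟨ +P-congʳ (1-X^ (suc K) *P P) (*P-congʳ u (absorbʳ K M)) ⟨
  1-X^ (suc K) *P P +P u *P (1-X^ (suc M) *P P)
    ≈⟨ collect u (X^ (suc M)) P ⟩
  (oneP +P negP (u *P X^ (suc M))) *P P
    ≈⟨ *P-congˡ P (1-X^-+ (suc K) (suc M)) ⟨
  1-X^ (suc (K + suc M)) *P P
    ∎
  where
  open ≋-Reasoning
  u = X^ (suc K)
  P = qbinom K (suc M)
  Q = qbinom K M
  R = qbinom (suc K) M
  expand : ∀ u P R → (oneP +P negP u) *P (P +P u *P R) ≋ (oneP +P negP u) *P P +P u *P ((oneP +P negP u) *P R)
  expand = solve-∀ ℤ[X]-almost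
  collect : ∀ u v P → (oneP +P negP u) *P P +P u *P ((oneP +P negP v) *P P) ≋ (oneP +P negP (u *P v)) *P P
  collect = solve-∀ ℤ[X]-almost

absorbʳ zero    M = ≋-refl
absorbʳ (suc K) M = begin
  1-X^ (suc M) *P (P +P u *P R)
    ≈⟨ expand (X^ (suc M)) u P R ⟩
  1-X^ (suc M) *P P +P u *P (1-X^ (suc M) *P R)
    ≈⟨ +P-congˡ (u *P (1-X^ (suc M) *P R)) (absorbʳ K M) ⟩
  1-X^ (suc (K + M)) *P Q +P u *P (1-X^ (suc M) *P R)
    ≈⟨ +P-congˡ (u *P (1-X^ (suc M) *P R)) (absorbˡ K M) ⟨
  1-X^ (suc K) *P R +P u *P (1-X^ (suc M) *P R)
    ≈⟨ collect u (X^ (suc M)) R ⟩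
  (oneP +P negP (u *P X^ (suc M))) *P R
    ≈⟨ *P-congˡ R (1-X^-+ (suc K) (suc M)) ⟨
  1-X^ (suc K + suc M) *P R
    ≡⟨ cong (λ n → 1-X^ (suc n) *P R) (ℕₚ.+-suc K M) ⟩
  1-X^ (suc (suc K + M)) *P R
    ∎
  where
  open ≋-Reasoning
  u = X^ (suc K)
  P = qbinom K (suc M)
  Q = qbinom K M
  R = qbinom (suc K) M
  expand : ∀ v u P R → (oneP +P negP v) *P (P +P u *P R) ≋ (oneP +P negP v) *P P +P u *P ((oneP +P negP v) *P R)
  expand = solve-∀ ℤ[X]-almost
  collect : ∀ u v R → (oneP +P negP u) *P R +P u *P ((oneP +P negP v) *P R) ≋ (oneP +P negP (u *P v)) *P R
  collect = solve-∀ ℤ[X]-almost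

-- Divisibility of Gaussian binomials by products of 1 + X^j

double≡2* : ∀ k → double k ≡ 2 * k
double≡2* zero    = refl
double≡2* (suc k) = ≡.trans (cong (suc ∘ suc) (double≡2* k)) (2[1+k] k)
  where
  2[1+k] : ∀ k → suc (suc (2 * k)) ≡ 2 * suc k
  2[1+k] = ℕ-Solver.solve-∀

double-+-suc : ∀ k m → suc (double k + suc (double m)) ≡ double (suc (k + m))
double-+-suc zero    m = refl
double-+-suc (suc k) m = cong (suc ∘ suc) (double-+-suc k m)

X^-double : ∀ a → X^ (double a) ≋ X^ a *P X^ a
X^-double a = begin
  X^ (double a)             ≡⟨ cong X^ (double≡2* a) ⟩
  X^ (a + (a + 0))          ≈⟨ X^-+ a (a + 0) ⟩
  X^ a *P X^ (a + 0)        ≡⟨ cong (λ n → X^ a *P X^ n) (ℕₚ.+-identityʳ a) ⟩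
  X^ a *P X^ a              ∎
  where open ≋-Reasoning

x∣yu∧u∣w⇒x∣yw : ∀ {d} f {u w} → d ∣ f *P u → u ∣ w → d ∣ f *P w
x∣yu∧u∣w⇒x∣yw f {u} {w} d∣fu (c , cu≋w) = ∣-respʳ-≈ (≋-trans (rearrange c f u) (*P-congʳ f cu≋w)) (x∣ʳy⇒x∣ʳzy c d∣fu)
  where
  rearrange : ∀ c f u → c *P (f *P u) ≋ f *P (c *P u)
  rearrange = solve-∀ ℤ[X]-almost

qbinom-pascal-∣ : ∀ K M {d U V W} → d ∣ qbinom K (suc M) *P U → d ∣ qbinom (suc K) M *P V → U ∣ W → V ∣ W →
                  d ∣ qbinom (suc K) (suc M) *P W
qbinom-pascal-∣ K M {W = W} d∣PU d∣RV U∣W V∣W = ∣-respʳ-≈ (≋-sym (distrib P (X^ (suc K)) R W))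
  (∣f∣g⇒∣f+g (x∣yu∧u∣w⇒x∣yw P d∣PU U∣W) (x∣ʳy⇒x∣ʳzy (X^ (suc K)) (x∣yu∧u∣w⇒x∣yw R d∣RV V∣W)))
  where
  P = qbinom K (suc M)
  R = qbinom (suc K) M
  distrib : ∀ P u R W → (P +P u *P R) *P W ≋ P *P W +P u *P (R *P W)
  distrib = solve-∀ ℤ[X]-almost

∏1+X^-double : ∀ s Y → ∏1+X^ s ∣ Y → ∏1+X^ (suc s) ∣ 1-X^ (double (suc s)) *P Y
∏1+X^-double s Y s∣Y = ∣-respʳ-≈ (≋-sym (begin
  1-X^ (double a) *P Y                    ≈⟨ *P-congˡ Y (+P-congʳ oneP (negP-cong (X^-double a))) ⟩
  (oneP +P negP (X^ a *P X^ a)) *P Y      ≈⟨ factor (X^ a) Y ⟩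
  1-X^ a *P (Y *P 1+X^ a)                 ∎))
  (x∣ʳy⇒x∣ʳzy (1-X^ a) (x∣ʳy⇒xz∣ʳyz (1+X^ a) s∣Y))
  where
  open ≋-Reasoning
  a = suc s
  factor : ∀ u Y → (oneP +P negP (u *P u)) *P Y ≋ (oneP +P negP u) *P (Y *P (oneP +P u))
  factor = solve-∀ ℤ[X]-almost

∏1+X^-absorb : ∀ s e G G′ T → 1-X^ e *P G ≋ 1-X^ (double (suc s)) *P G′ →
               ∏1+X^ s ∣ G′ *P T → ∏1+X^ (suc s) ∣ 1-X^ e *P (G *P T)
∏1+X^-absorb s e G G′ T eG≋ s∣G′T = ∣-respʳ-≈ (≋-sym (begin
  1-X^ e *P (G *P T)                      ≈⟨ *P-assoc (1-X^ e) G T ⟨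
  (1-X^ e *P G) *P T                      ≈⟨ *P-congˡ T eG≋ ⟩
  (1-X^ (double (suc s)) *P G′) *P T      ≈⟨ *P-assoc (1-X^ (double (suc s))) G′ T ⟩
  1-X^ (double (suc s)) *P (G′ *P T)      ∎))
  (∏1+X^-double s (G′ *P T) s∣G′T)
  where open ≋-Reasoning

merge-1+X^ˡ : ∀ a G A B → 1-X^ a *P (G *P ((A *P 1+X^ a) *P B)) ≋ 1-X^ (double a) *P (G *P (A *P B))
merge-1+X^ˡ a G A B =
  ≋-trans (merge (X^ a) G A B) (*P-congˡ (G *P (A *P B)) (+P-congʳ oneP (negP-cong (≋-sym (X^-double a)))))
  where
  merge : ∀ u G A B → (oneP +P negP u) *P (G *P ((A *P (oneP +P u)) *P B))
                    ≋ (oneP +P negP (u *P u)) *P (G *P (A *P B))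
  merge = solve-∀ ℤ[X]-almost

merge-1+X^ʳ : ∀ a G A B → 1-X^ a *P (G *P (A *P (B *P 1+X^ a))) ≋ 1-X^ (double a) *P (G *P (A *P B))
merge-1+X^ʳ a G A B =
  ≋-trans (merge (X^ a) G A B) (*P-congˡ (G *P (A *P B)) (+P-congʳ oneP (negP-cong (≋-sym (X^-double a)))))
  where
  merge : ∀ u G A B → (oneP +P negP u) *P (G *P (A *P (B *P (oneP +P u))))
                    ≋ (oneP +P negP (u *P u)) *P (G *P (A *P B))
  merge = solve-∀ ℤ[X]-almost

∏∏∣∏∏suc : ∀ k m → ∏1+X^ k *P ∏1+X^ m ∣ ∏1+X^ k *P ∏1+X^ (suc m)
∏∏∣∏∏suc k m = x∣y⇒zx∣zy (∏1+X^ k) (x∣xy (∏1+X^ m) (1+X^ (suc m)))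

∏∏∣∏suc∏ : ∀ k m → ∏1+X^ k *P ∏1+X^ m ∣ ∏1+X^ (suc k) *P ∏1+X^ m
∏∏∣∏suc∏ k m = x∣ʳy⇒xz∣ʳyz (∏1+X^ m) (x∣xy (∏1+X^ k) (1+X^ (suc k)))

∏∣qbinom-zeroˡ : ∀ M m → ∏1+X^ (0 + m) ∣ qbinom 0 M *P (∏1+X^ 0 *P ∏1+X^ m)
∏∣qbinom-zeroˡ M m = ∣ʳ-reflexive (unit (∏1+X^ m))
  where
  unit : ∀ p → p ≋ oneP *P (oneP *P p)
  unit = solve-∀ ℤ[X]-almost

∏∣qbinom-zeroʳ : ∀ K k → ∏1+X^ (k + 0) ∣ qbinom K 0 *P (∏1+X^ k *P ∏1+X^ 0)
∏∣qbinom-zeroʳ K k rewrite ℕₚ.+-identityʳ k | qbinom-zeroʳ K = ∣ʳ-reflexive (unit (∏1+X^ k))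
  where
  unit : ∀ p → p ≋ oneP *P (p *P oneP)
  unit = solve-∀ ℤ[X]-almost

∏∣qbinom[2k,2m]     : ∀ k m → ∏1+X^ (k + m) ∣ qbinom (double k) (double m) *P (∏1+X^ k *P ∏1+X^ m)
∏∣qbinom[2k+1,2m]   : ∀ k m → ∏1+X^ (k + m) ∣ qbinom (suc (double k)) (double m) *P (∏1+X^ k *P ∏1+X^ m)
∏∣qbinom[2k,2m+1]   : ∀ k m → ∏1+X^ (k + m) ∣ qbinom (double k) (suc (double m)) *P (∏1+X^ k *P ∏1+X^ m)
∏∣qbinom[2k+1,2m+1] : ∀ k m → ∏1+X^ (suc (k + m)) ∣ qbinom (suc (double k)) (suc (double m)) *P (∏1+X^ k *P ∏1+X^ m)

∏∣qbinom[2k,2m] zero    m       = ∏∣qbinom-zeroˡ (double m) m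
∏∣qbinom[2k,2m] (suc k) zero    = ∏∣qbinom-zeroʳ (double (suc k)) (suc k)
∏∣qbinom[2k,2m] (suc k) (suc m) = subst (λ s → ∏1+X^ s ∣ Z) (≡.sym (cong suc (ℕₚ.+-suc k m)))
  (∏1+X^-extend-+ s Z (suc k) (suc m) (cong suc (ℕₚ.+-suc k m)) s∣Z ∣[1-X^k+1]Z ∣[1-X^m+1]Z)
  where
  s = suc (k + m)
  G = qbinom (double (suc k)) (double (suc m))
  Z = G *P (∏1+X^ (suc k) *P ∏1+X^ (suc m))
  G₁ = qbinom (suc (double k)) (double (suc m))
  G₂ = qbinom (double (suc k)) (suc (double m))
  odd-even : ∏1+X^ s ∣ G₁ *P (∏1+X^ k *P ∏1+X^ (suc m))
  odd-even = subst (λ s → ∏1+X^ s ∣ G₁ *P (∏1+X^ k *P ∏1+X^ (suc m))) (ℕₚ.+-suc k m) (∏∣qbinom[2k+1,2m] k (suc m))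
  even-odd : ∏1+X^ s ∣ G₂ *P (∏1+X^ (suc k) *P ∏1+X^ m)
  even-odd = ∏∣qbinom[2k,2m+1] (suc k) m
  s∣Z : ∏1+X^ s ∣ Z
  s∣Z = qbinom-pascal-∣ (suc (double k)) (suc (double m)) odd-even even-odd (∏∏∣∏suc∏ k (suc m)) (∏∏∣∏∏suc (suc k) m)
  ∣[1-X^k+1]Z : ∏1+X^ (suc s) ∣ 1-X^ (suc k) *P Z
  ∣[1-X^k+1]Z = ∣-respʳ-≈ (≋-sym (merge-1+X^ˡ (suc k) G (∏1+X^ k) (∏1+X^ (suc m))))
    (∏1+X^-absorb s (double (suc k)) G G₁ (∏1+X^ k *P ∏1+X^ (suc m))
      (≋-trans (absorbˡ (suc (double k)) (double (suc m))) (*P-congˡ G₁ (≡⇒≋ (cong 1-X^_ e₁)))) odd-even)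
    where
    e₁ : suc (suc (double k) + double (suc m)) ≡ double (suc s)
    e₁ = cong (suc ∘ suc) (≡.trans (ℕₚ.+-suc (double k) (suc (double m))) (double-+-suc k m))
  ∣[1-X^m+1]Z : ∏1+X^ (suc s) ∣ 1-X^ (suc m) *P Z
  ∣[1-X^m+1]Z = ∣-respʳ-≈ (≋-sym (merge-1+X^ʳ (suc m) G (∏1+X^ (suc k)) (∏1+X^ m)))
    (∏1+X^-absorb s (double (suc m)) G G₂ (∏1+X^ (suc k) *P ∏1+X^ m)
      (≋-trans (absorbʳ (double (suc k)) (suc (double m))) (*P-congˡ G₂ (≡⇒≋ (cong 1-X^_ e₂)))) even-odd)
    where
    e₂ : suc (double (suc k) + suc (double m)) ≡ double (suc s)
    e₂ = cong (suc ∘ suc) (double-+-suc k m)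

∏∣qbinom[2k+1,2m] k zero    = ∏∣qbinom-zeroʳ (suc (double k)) k
∏∣qbinom[2k+1,2m] k (suc m) = qbinom-pascal-∣ (double k) (suc (double m)) (∏∣qbinom[2k,2m] k (suc m))
  (subst (λ s → ∏1+X^ s ∣ qbinom (suc (double k)) (suc (double m)) *P (∏1+X^ k *P ∏1+X^ m)) (≡.sym (ℕₚ.+-suc k m))
    (∏∣qbinom[2k+1,2m+1] k m))
  ∣ʳ-refl (∏∏∣∏∏suc k m)

∏∣qbinom[2k,2m+1] zero    m = ∏∣qbinom-zeroˡ (suc (double m)) m
∏∣qbinom[2k,2m+1] (suc k) m =
  qbinom-pascal-∣ (suc (double k)) (double m) (∏∣qbinom[2k+1,2m+1] k m) (∏∣qbinom[2k,2m] (suc k) m) (∏∏∣∏suc∏ k m) ∣ʳ-refl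

∏∣qbinom[2k+1,2m+1] k m = ∏1+X^-extend-odd s Z k s∣Z
  (∏1+X^-absorb s (suc (double k)) G G′ (∏1+X^ k *P ∏1+X^ m)
    (≋-trans (absorbˡ (double k) (suc (double m))) (*P-congˡ G′ (≡⇒≋ (cong 1-X^_ (double-+-suc k m)))))
    (∏∣qbinom[2k,2m+1] k m))
  where
  s = k + m
  G = qbinom (suc (double k)) (suc (double m))
  G′ = qbinom (double k) (suc (double m))
  Z = G *P (∏1+X^ k *P ∏1+X^ m)
  s∣Z : ∏1+X^ s ∣ Z
  s∣Z = qbinom-pascal-∣ (double k) (double m) (∏∣qbinom[2k,2m+1] k m) (∏∣qbinom[2k+1,2m] k m) ∣ʳ-refl ∣ʳ-refl

∏1+X^*poch : ∀ s k → ∏1+X^ s *P poch (negP (X^ (s + 1))) k ≋ ∏1+X^ (s + k)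
∏1+X^*poch s zero    = ≋-trans (*P-identityʳ (∏1+X^ s)) (≡⇒≋ (cong ∏1+X^_ (≡.sym (ℕₚ.+-identityʳ s))))
∏1+X^*poch s (suc k) = begin
  ∏1+X^ s *P (poch a k *P (oneP +P negP (a *P X^ k)))
    ≈⟨ *P-assoc (∏1+X^ s) (poch a k) (oneP +P negP (a *P X^ k)) ⟨
  (∏1+X^ s *P poch a k) *P (oneP +P negP (a *P X^ k))
    ≈⟨ *P-cong (∏1+X^*poch s k) (≋-trans (neg-neg (X^ (s + 1)) (X^ k)) (+P-congʳ oneP X^s+1+k)) ⟩
  ∏1+X^ (s + k) *P 1+X^ (suc (s + k))
    ≡⟨ cong ∏1+X^_ (ℕₚ.+-suc s k) ⟨
  ∏1+X^ (s + suc k)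
    ∎
  where
  open ≋-Reasoning
  a = negP (X^ (s + 1))
  neg-neg : ∀ u v → oneP +P negP (negP u *P v) ≋ oneP +P u *P v
  neg-neg = solve-∀ ℤ[X]-almost
  X^s+1+k : X^ (s + 1) *P X^ k ≋ X^ (suc (s + k))
  X^s+1+k = ≋-trans (≋-sym (X^-+ (s + 1) k)) (≡⇒≋ (cong X^ (+1+ s k)))
    where
    +1+ : ∀ s k → s + 1 + k ≡ suc (s + k)
    +1+ = ℕ-Solver.solve-∀

poch[-X]≋∏1+X^ : ∀ k → poch (negP (X^ 1)) k ≋ ∏1+X^ k
poch[-X]≋∏1+X^ k = ≋-trans (≋-sym (*P-identityˡ (poch (negP (X^ 1)) k))) (∏1+X^*poch 0 k)

∣⇒∣P : ∀ {d f} → d ∣ f → d ∣P f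
∣⇒∣P {d} (q , qd≋f) = q , coeff-≡ (≋-sym (≋-trans (*P-comm d q) qd≋f))

∏∣qbinom⇒poch∣ : ∀ k m {G G′} → G ≋ G′ → ∏1+X^ (k + m) ∣ G′ *P (∏1+X^ k *P ∏1+X^ m) →
                 poch (negP (X^ (m + 1))) k ∣P poch (negP (X^ 1)) k *P G
∏∣qbinom⇒poch∣ k m {G} {G′} G≋G′ ∏∣G′ = ∣⇒∣P (∏1+X^-∣-cancelˡ m B (poch (negP (X^ 1)) k *P G)
  (∣ʳ-respˡ-≈ ∏1+X^[k+m]≋ (∣ʳ-respʳ-≈ G′∏∏≋ ∏∣G′)))
  where
  open ≋-Reasoning
  B = poch (negP (X^ (m + 1))) k
  rearrange : ∀ a b g → g *P (b *P a) ≋ a *P (b *P g)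
  rearrange = solve-∀ ℤ[X]-almost
  ∏1+X^[k+m]≋ : ∏1+X^ (k + m) ≋ ∏1+X^ m *P B
  ∏1+X^[k+m]≋ = ≋-sym (≋-trans (∏1+X^*poch m k) (≡⇒≋ (cong ∏1+X^_ (ℕₚ.+-comm m k))))
  G′∏∏≋ : G′ *P (∏1+X^ k *P ∏1+X^ m) ≋ ∏1+X^ m *P (poch (negP (X^ 1)) k *P G)
  G′∏∏≋ = begin
    G′ *P (∏1+X^ k *P ∏1+X^ m)                  ≈⟨ *P-congˡ (∏1+X^ k *P ∏1+X^ m) G≋G′ ⟨
    G *P (∏1+X^ k *P ∏1+X^ m)                   ≈⟨ rearrange (∏1+X^ m) (∏1+X^ k) G ⟩
    ∏1+X^ m *P (∏1+X^ k *P G)                   ≈⟨ *P-congʳ (∏1+X^ m) (*P-congˡ G (poch[-X]≋∏1+X^ k)) ⟨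
    ∏1+X^ m *P (poch (negP (X^ 1)) k *P G)      ∎

gauss[2n,2k]≋qbinom : ∀ n k → k ≤ n → gauss (2 * n) (2 * k) ≋ qbinom (double k) (double (n ∸ k))
gauss[2n,2k]≋qbinom n k k≤n = ≋-trans (≡⇒≋ (cong₂ gauss (begin
    2 * n                          ≡⟨ cong (2 *_) (ℕₚ.m+[n∸m]≡n k≤n) ⟨
    2 * (k + m)                    ≡⟨ ℕₚ.*-distribˡ-+ 2 k m ⟩
    2 * k + 2 * m                  ≡⟨ cong₂ _+_ (double≡2* k) (double≡2* m) ⟨
    double k + double m            ∎) (≡.sym (double≡2* k))))
  (gauss≋qbinom (double k) (double m))
  where
  open ≡.≡-Reasoning
  m = n ∸ k

gauss[2n+1,2k+1]≋qbinom : ∀ n k → k ≤ n → gauss (2 * n + 1) (2 * k + 1) ≋ qbinom (suc (double k)) (double (n ∸ k))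
gauss[2n+1,2k+1]≋qbinom n k k≤n = ≋-trans (≡⇒≋ (cong₂ gauss (begin
    2 * n + 1                      ≡⟨ cong (λ n → 2 * n + 1) (ℕₚ.m+[n∸m]≡n k≤n) ⟨
    2 * (k + m) + 1                ≡⟨ distrib k m ⟩
    suc (2 * k + 2 * m)            ≡⟨ cong₂ (λ a b → suc (a + b)) (double≡2* k) (double≡2* m) ⟨
    suc (double k) + double m      ∎) (≡.trans (ℕₚ.+-comm (2 * k) 1) (cong suc (≡.sym (double≡2* k))))))
  (gauss≋qbinom (suc (double k)) (double m))
  where
  open ≡.≡-Reasoning
  m = n ∸ k
  distrib : ∀ k m → 2 * (k + m) + 1 ≡ suc (2 * k + 2 * m)
  distrib = ℕ-Solver.solve-∀

lemma4p2 : (n k : ℕ) → 1 ≤ k → k ≤ n →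
    (poch (negP (X^ (n ∸ k + 1))) k ∣P poch (negP (X^ 1)) k *P gauss (2 * n) (2 * k))
    × (poch (negP (X^ (n ∸ k + 1))) k ∣P poch (negP (X^ 1)) k *P gauss (2 * n + 1) (2 * k + 1))
lemma4p2 n k _ k≤n =
    ∏∣qbinom⇒poch∣ k (n ∸ k) (gauss[2n,2k]≋qbinom n k k≤n) (∏∣qbinom[2k,2m] k (n ∸ k))
  , ∏∣qbinom⇒poch∣ k (n ∸ k) (gauss[2n+1,2k+1]≋qbinom n k k≤n) (∏∣qbinom[2k+1,2m] k (n ∸ k))
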